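{- Let $P$ be an associative (resp. normal) poset, $I$ a set, and for each $i\in I$ let $P_i$ be an isomorphic copy of $P$ (with the $P_i$ pairwise disjoint). Then the disjoint union $\bigsqcup_{i\in I}P_i$ is associative (resp. normal).
   Context: A binary operation $\cdot$ on a poset $(P,\leq)$ is admissible if for all $x,y\in P$: $x\leq y\iff x\cdot y=x$. A right-regular band (RRB) is a set with an associative binary operation satisfying $x\cdot x=x$ and $x\cdot y\cdot x=y\cdot x$; a right-normal band is one satisfying additionally $x\cdot y\cdot z=y\cdot x\cdot z$. A poset is associative (resp. normal) if it admits an admissible RRB (resp. right-normal band) operation. In a disjoint union of posets, elements of distinct summands are incomparable. -}

module Defs where

open import Level using (Level; _⊔_; suc)
open import Data.Product using (Σ; _×_; _,_; ∃)
open import Relation.Binary.PropositionalEquality using (_≡_)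
open import Relation.Binary.Structures using (IsPartialOrder)
open import Relation.Binary.Core using (Rel)

record Poset′ (c ℓ : Level) : Set (suc (c ⊔ ℓ)) where
  field
    Carrier        : Set c
    _≤_            : Rel Carrier ℓ
    isPartialOrder : IsPartialOrder _≡_ _≤_

module _ {c ℓ} (P : Poset′ c ℓ) where
  open Poset′ P

  Admissible : (Carrier → Carrier → Carrier) → Set (c ⊔ ℓ)
  Admissible _·_ = ∀ x y → (x ≤ y → (x · y) ≡ x) × ((x · y) ≡ x → x ≤ y)

  IsRRB : (Carrier → Carrier → Carrier) → Set c
  IsRRB _·_ = (∀ x y z → ((x · y) · z) ≡ (x · (y · z)))
            × (∀ x → (x · x) ≡ x)
            × (∀ x y → ((x · y) · x) ≡ (y · x))

  IsRightNormalBand : (Carrier → Carrier → Carrier) → Set c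
  IsRightNormalBand _·_ = IsRRB _·_
            × (∀ x y z → ((x · y) · z) ≡ ((y · x) · z))

  Associative : Set (c ⊔ ℓ)
  Associative = Σ (Carrier → Carrier → Carrier) λ op → Admissible op × IsRRB op

  Normal : Set (c ⊔ ℓ)
  Normal = Σ (Carrier → Carrier → Carrier) λ op → Admissible op × IsRightNormalBand op

data _≤⊔_ {a c ℓ} {I : Set a} {P : Poset′ c ℓ}
     : Rel (Σ I (λ _ → Poset′.Carrier P)) (a ⊔ c ⊔ ℓ) where
  within : ∀ {i x y} → Poset′._≤_ P x y → (i , x) ≤⊔ (i , y)

module _ {a c ℓ} {I : Set a} {P : Poset′ c ℓ} where
  open Poset′ P
  open IsPartialOrder isPartialOrder using (reflexive; antisym)
  open import Relation.Binary.PropositionalEquality using (refl; isEquivalence)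

  private
    C = Σ I (λ _ → Carrier)

    ≤⊔-refl : ∀ {p q : C} → p ≡ q → _≤⊔_ {P = P} p q
    ≤⊔-refl {i , x} refl = within (reflexive refl)

    ≤⊔-trans : ∀ {p q r : C} → _≤⊔_ {P = P} p q → _≤⊔_ {P = P} q r → _≤⊔_ {P = P} p r
    ≤⊔-trans (within a) (within b) = within (IsPartialOrder.trans isPartialOrder a b)

    ≤⊔-antisym : ∀ {p q : C} → _≤⊔_ {P = P} p q → _≤⊔_ {P = P} q p → p ≡ q
    ≤⊔-antisym (within a) (within b) with antisym a b
    ... | refl = refl

  ≤⊔-isPartialOrder : IsPartialOrder _≡_ (_≤⊔_ {P = P})
  ≤⊔-isPartialOrder = record
    { isPreorder = record
      { isEquivalence = isEquivalence ; reflexive = ≤⊔-refl ; trans = ≤⊔-trans }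
    ; antisym = ≤⊔-antisym }

DisjointUnion : ∀ {a c ℓ} (I : Set a) (P : Poset′ c ℓ) → Poset′ (a ⊔ c) (a ⊔ c ⊔ ℓ)
DisjointUnion I P = record
  { Carrier = Σ I (λ _ → Poset′.Carrier P)
  ; _≤_ = _≤⊔_ {I = I} {P = P}
  ; isPartialOrder = ≤⊔-isPartialOrder }

{-# OPTIONS --safe #-}
-- Give ⨆ᵢ Pᵢ = I × P the operation (i , x) ⋆ (j , y) = (j , x · y), the product of the band
-- on P with the right-zero band on I. Both sides of each band identity end in the same
-- variable, so they agree on the index, and on the second coordinate they agree by the
-- identity in P. Admissibility transfers because (i , x) ⋆ (j , y) = (i , x) says exactly
-- that j = i and x · y = x.
module Submission where

open import Defs
open import Level using (Level)
open import Algebra.Core using (Op₂)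
open import Data.Product using (_×_; _,_; proj₁; proj₂)
open import Data.Product.Properties using (,-injective)
open import Relation.Binary.PropositionalEquality using (_≡_; refl; cong)

module RightZeroProduct {a c} (I : Set a) {A : Set c} (_·_ : Op₂ A) where

  _⋆_ : Op₂ (I × A)
  (_ , x) ⋆ (j , y) = j , x · y

  ⋆-assoc : (∀ x y z → ((x · y) · z) ≡ (x · (y · z))) →
            ∀ p q r → ((p ⋆ q) ⋆ r) ≡ (p ⋆ (q ⋆ r))
  ⋆-assoc assoc (_ , x) (_ , y) (k , z) = cong (k ,_) (assoc x y z)

  ⋆-idem : (∀ x → (x · x) ≡ x) → ∀ p → (p ⋆ p) ≡ p
  ⋆-idem idem (i , x) = cong (i ,_) (idem x)

  ⋆-rightRegular : (∀ x y → ((x · y) · x) ≡ (y · x)) →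
                   ∀ p q → ((p ⋆ q) ⋆ p) ≡ (q ⋆ p)
  ⋆-rightRegular regular (i , x) (_ , y) = cong (i ,_) (regular x y)

  ⋆-rightNormal : (∀ x y z → ((x · y) · z) ≡ ((y · x) · z)) →
                  ∀ p q r → ((p ⋆ q) ⋆ r) ≡ ((q ⋆ p) ⋆ r)
  ⋆-rightNormal normal (_ , x) (_ , y) (k , z) = cong (k ,_) (normal x y z)

module _ {a c ℓ} (P : Poset′ c ℓ) (I : Set a) (_·_ : Op₂ (Poset′.Carrier P)) where
  open Poset′ (DisjointUnion I P) using () renaming (_≤_ to _≤ᴰ_)
  open RightZeroProduct I _·_

  ⋆-fixed⇒≤ᴰ : Admissible P _·_ → ∀ {i j x y} → (j , x · y) ≡ (i , x) → (i , x) ≤ᴰ (j , y)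
  ⋆-fixed⇒≤ᴰ admissible {x = x} {y} eq with ,-injective eq
  ... | refl , xy≡x = within (proj₂ (admissible x y) xy≡x)

  admissible-⋆ : Admissible P _·_ → Admissible (DisjointUnion I P) _⋆_
  admissible-⋆ admissible (i , x) (j , y) = ≤ᴰ⇒⋆-fixed , ⋆-fixed⇒≤ᴰ admissible
    where
    ≤ᴰ⇒⋆-fixed : (i , x) ≤ᴰ (j , y) → (j , x · y) ≡ (i , x)
    ≤ᴰ⇒⋆-fixed (within x≤y) = cong (i ,_) (proj₁ (admissible x y) x≤y)

  isRRB-⋆ : IsRRB P _·_ → IsRRB (DisjointUnion I P) _⋆_
  isRRB-⋆ (assoc , idem , regular) = ⋆-assoc assoc , ⋆-idem idem , ⋆-rightRegular regular

  isRightNormalBand-⋆ : IsRightNormalBand P _·_ → IsRightNormalBand (DisjointUnion I P) _⋆_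
  isRightNormalBand-⋆ (rrb , normal) = isRRB-⋆ rrb , ⋆-rightNormal normal

lemma4p2 : ∀ {a c ℓ : Level} (P : Poset′ c ℓ) (I : Set a) →
    (Associative P → Associative (DisjointUnion I P))
    × (Normal P → Normal (DisjointUnion I P))
lemma4p2 P I =
    (λ (op , admissible , rrb) →
       _ , admissible-⋆ P I op admissible , isRRB-⋆ P I op rrb)
  , (λ (op , admissible , rnb) →
       _ , admissible-⋆ P I op admissible , isRightNormalBand-⋆ P I op rnb)
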